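{- Let $G$ and $G^*$ be graphs on the same vertex set $V=\{v_1,\dots,v_n\}$ with adjacency matrices $A$ and $A^*$, and let $S,S^*\subseteq V$ be non-empty with $W^S_G=W^{S^*}_{G^*}$. If this walk matrix has rank $n-1$, then $A=A^*$. (That is, a walk matrix of rank $|V|-1$ determines the adjacency matrix.)
   Context: Graphs are finite, simple, undirected. For a graph $G$ with vertex set $V=\{v_1,\dots,v_n\}$, adjacency matrix $A$, and non-empty $S\subseteq V$ with characteristic vector ${\rm e}\in\{0,1\}^n$, the walk matrix is $W^S_G=[{\rm e},A{\rm e},\dots,A^{n-1}{\rm e}]$. -}

module Defs where

open import Data.Nat using (ℕ; zero; suc)
open import Data.Bool using (Bool; true; false; T; not)
open import Data.Fin using (Fin; zero; suc; toℕ)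
open import Data.Rational using (ℚ; 0ℚ; 1ℚ; _+_; _*_)
open import Data.Product using (Σ; _×_; ∃; ∃-syntax)
open import Relation.Binary.PropositionalEquality using (_≡_; _≢_)
open import Relation.Nullary using (¬_)
open import Function.Definitions using (Injective)

-- A finite simple undirected graph on vertex set Fin n (v_i ↔ index i):
-- a symmetric, irreflexive adjacency relation given as a Bool matrix.
record Graph (n : ℕ) : Set where
  field
    adj       : Fin n → Fin n → Bool
    symmetric : ∀ i j → adj i j ≡ adj j i
    irreflexive : ∀ i → adj i i ≡ false
open Graph public

Vec : ℕ → Set
Vec n = Fin n → ℚ

Mat : ℕ → ℕ → Set
Mat m k = Fin m → Fin k → ℚ

Σ[<_] : (n : ℕ) → (Fin n → ℚ) → ℚ
Σ[< zero ] f = 0ℚ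
Σ[< suc n ] f = f zero + Σ[< n ] (λ i → f (suc i))

b2q : Bool → ℚ
b2q true = 1ℚ
b2q false = 0ℚ

adjMat : ∀ {n} → Graph n → Mat n n
adjMat G i j = b2q (adj G i j)

Subset : ℕ → Set
Subset n = Fin n → Bool

NonEmpty : ∀ {n} → Subset n → Set
NonEmpty {n} S = ∃[ i ] S i ≡ true

charVec : ∀ {n} → Subset n → Vec n
charVec S i = b2q (S i)

_·_ : ∀ {m k} → Mat m k → Vec k → Vec m
(M · v) i = Σ[< _ ] (λ j → M i j * v j)

powApply : ∀ {n} → Mat n n → ℕ → Vec n → Vec n
powApply A zero v = v
powApply A (suc k) v = A · powApply A k v

walkMatrix : ∀ {n} → Graph n → Subset n → Mat n n
walkMatrix {n} G S i j = powApply (adjMat G) (toℕ j) (charVec S) i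

ColumnsIndependent : ∀ {m k r} → Mat m k → (Fin r → Fin k) → Set
ColumnsIndependent {m} {k} {r} M f =
  ∀ (c : Fin r → ℚ) → (∀ i → Σ[< r ] (λ j → M i (f j) * c j) ≡ 0ℚ) → ∀ j → c j ≡ 0ℚ

RankAtLeast : ∀ {m k} → Mat m k → ℕ → Set
RankAtLeast {m} {k} M r = ∃[ f ] (Injective _≡_ _≡_ f × ColumnsIndependent {m} {k} {r} M f)

HasRank : ∀ {m k} → Mat m k → ℕ → Set
HasRank M r = RankAtLeast M r × ¬ RankAtLeast M (suc r)

module Submission where

-- Write w_t = A^t e and w*_t = A*^t e*.  Equal walk matrices give w_t = w*_t
-- for t < n, so D = A − A* annihilates w_0, …, w_{n−2}.  Suppose D i j ≠ 0.
--  * D is symmetric with zero diagonal, so it is injective on span(e_i, e_j);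
--    as it kills w_0, …, w_{n−2}, these n − 1 vectors are linearly dependent:
--    Σ_l c_l w_l = 0 for some c ≠ 0.
--  * Then both (c, 0) and (0, c) lie in the kernel of the walk matrix W, the
--    latter because W (0, c) = A (Σ_l c_l w_l).  These two vectors are
--    independent, but W has n − 1 independent columns, hence nullity at most
--    one — a contradiction.
-- Every linear-algebra step rests on Gaussian elimination (a homogeneous
-- system with more unknowns than equations has a nontrivial solution).

open import Defs
open import Data.Nat using (ℕ; zero; suc; _∸_; _≤_; _<_; s≤s)
open import Data.Nat.Properties using (≤-refl; <⇒≤)
open import Data.Fin using (Fin; zero; suc; toℕ; fromℕ<; punchIn; punchOut)
open import Data.Fin.Properties using (all?; ¬∀⟶∃¬; punchIn-punchOut; toℕ-fromℕ<; toℕ<n)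
  renaming (_≟_ to _≟ᶠ_)
open import Data.Rational using (ℚ; 0ℚ; 1ℚ; _+_; _*_; -_; _-_; 1/_; NonZero; _≟_; ≢-nonZero)
import Data.Rational.Properties as ℚ
open import Data.Rational.Solver using (module +-*-Solver)
open +-*-Solver using (solve; _:+_; _:*_; _:-_; :-_; _:=_)
open import Data.Vec.Functional using (_∷_)
open import Data.Product using (∃; ∃₂; _×_; _,_; proj₁; proj₂)
open import Data.Sum using (_⊎_; inj₁; inj₂)
open import Data.Empty using (⊥; ⊥-elim)
open import Function using (_∘_)
open import Relation.Nullary using (yes; no)
open import Relation.Binary.PropositionalEquality
open import Algebra.Properties.Group ℚ.+-0-group using (x∙y⁻¹≈ε⇒x≈y)
open import Algebra.Properties.Ring ℚ.+-*-ring using ([y-z]x≈yx-zx)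

*-cancel-zeroʳ : ∀ a b → a * b ≡ 0ℚ → b ≢ 0ℚ → a ≡ 0ℚ
*-cancel-zeroʳ a b ab≡0 b≢0 = begin
    a               ≡⟨ sym (ℚ.*-identityʳ a) ⟩
    a * 1ℚ          ≡⟨ cong (a *_) (sym (ℚ.*-inverseʳ b)) ⟩
    a * (b * 1/ b)  ≡⟨ sym (ℚ.*-assoc a b (1/ b)) ⟩
    a * b * 1/ b    ≡⟨ cong (_* 1/ b) ab≡0 ⟩
    0ℚ * 1/ b       ≡⟨ ℚ.*-zeroˡ (1/ b) ⟩
    0ℚ              ∎
  where
    open ≡-Reasoning
    instance _ = ≢-nonZero b≢0

*-cancel-zeroˡ : ∀ a b → a * b ≡ 0ℚ → a ≢ 0ℚ → b ≡ 0ℚ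
*-cancel-zeroˡ a b ab≡0 = *-cancel-zeroʳ b a (trans (ℚ.*-comm b a) ab≡0)

*-vanishʳ : ∀ a {b} → b ≡ 0ℚ → a * b ≡ 0ℚ
*-vanishʳ a refl = ℚ.*-zeroʳ a

*-vanishˡ : ∀ {a} b → a ≡ 0ℚ → a * b ≡ 0ℚ
*-vanishˡ b refl = ℚ.*-zeroˡ b

+-cancel-zeroˡ : ∀ {s t} → s ≡ 0ℚ → s + t ≡ 0ℚ → t ≡ 0ℚ
+-cancel-zeroˡ {t = t} refl s+t≡0 = trans (sym (ℚ.+-identityˡ t)) s+t≡0

+-cancel-zeroʳ : ∀ {s t} → t ≡ 0ℚ → s + t ≡ 0ℚ → s ≡ 0ℚ
+-cancel-zeroʳ {s = s} refl s+t≡0 = trans (sym (ℚ.+-identityʳ s)) s+t≡0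

Σ-cong : ∀ n {f g : Fin n → ℚ} → (∀ i → f i ≡ g i) → Σ[< n ] f ≡ Σ[< n ] g
Σ-cong zero    f≡g = refl
Σ-cong (suc n) f≡g = cong₂ _+_ (f≡g zero) (Σ-cong n (f≡g ∘ suc))

Σ-zero : ∀ n {f : Fin n → ℚ} → (∀ i → f i ≡ 0ℚ) → Σ[< n ] f ≡ 0ℚ
Σ-zero zero    f≡0 = refl
Σ-zero (suc n) f≡0 = trans (cong₂ _+_ (f≡0 zero) (Σ-zero n (f≡0 ∘ suc))) (ℚ.+-identityˡ 0ℚ)

Σ-+ : ∀ n (f g : Fin n → ℚ) → Σ[< n ] (λ i → f i + g i) ≡ Σ[< n ] f + Σ[< n ] g
Σ-+ zero    f g = refl
Σ-+ (suc n) f g = trans (cong (f zero + g zero +_) (Σ-+ n (f ∘ suc) (g ∘ suc)))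
                        (interchange (f zero) (g zero) (Σ[< n ] (f ∘ suc)) (Σ[< n ] (g ∘ suc)))
  where
    interchange : ∀ a b c d → (a + b) + (c + d) ≡ (a + c) + (b + d)
    interchange = solve 4 (λ a b c d → (a :+ b) :+ (c :+ d) := (a :+ c) :+ (b :+ d)) refl

Σ-- : ∀ n (f g : Fin n → ℚ) → Σ[< n ] (λ i → f i - g i) ≡ Σ[< n ] f - Σ[< n ] g
Σ-- zero    f g = refl
Σ-- (suc n) f g = trans (cong (f zero - g zero +_) (Σ-- n (f ∘ suc) (g ∘ suc)))
                        (interchange (f zero) (g zero) (Σ[< n ] (f ∘ suc)) (Σ[< n ] (g ∘ suc)))
  where
    interchange : ∀ a b c d → (a - b) + (c - d) ≡ (a + c) - (b + d)
    interchange = solve 4 (λ a b c d → (a :- b) :+ (c :- d) := (a :+ c) :- (b :+ d)) refl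

Σ-*ˡ : ∀ n x (f : Fin n → ℚ) → Σ[< n ] (λ i → x * f i) ≡ x * Σ[< n ] f
Σ-*ˡ zero    x f = sym (ℚ.*-zeroʳ x)
Σ-*ˡ (suc n) x f = trans (cong (x * f zero +_) (Σ-*ˡ n x (f ∘ suc)))
                         (sym (ℚ.*-distribˡ-+ x (f zero) (Σ[< n ] (f ∘ suc))))

Σ-*ʳ : ∀ n x (f : Fin n → ℚ) → Σ[< n ] (λ i → f i * x) ≡ Σ[< n ] f * x
Σ-*ʳ zero    x f = sym (ℚ.*-zeroˡ x)
Σ-*ʳ (suc n) x f = trans (cong (f zero * x +_) (Σ-*ʳ n x (f ∘ suc)))
                         (sym (ℚ.*-distribʳ-+ x (f zero) (Σ[< n ] (f ∘ suc))))

Σ-swap : ∀ n m (F : Fin n → Fin m → ℚ) →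
         Σ[< n ] (λ i → Σ[< m ] (F i)) ≡ Σ[< m ] (λ j → Σ[< n ] (λ i → F i j))
Σ-swap zero    m F = sym (Σ-zero m (λ _ → refl))
Σ-swap (suc n) m F = trans (cong (Σ[< m ] (F zero) +_) (Σ-swap n m (F ∘ suc)))
                           (sym (Σ-+ m (F zero) (λ j → Σ[< n ] (λ i → F (suc i) j))))

InKernel : ∀ {k m} → Mat k m → Vec m → Set
InKernel M c = ∀ i → (M · c) i ≡ 0ℚ

Nontrivial : ∀ {m} → Vec m → Set
Nontrivial c = ∃ λ l → c l ≢ 0ℚ

_⊗_ : ∀ {k p m} → Mat k p → Mat p m → Mat k m
(M ⊗ N) i l = (M · (λ p → N p l)) i

·-assoc : ∀ {k p m} (M : Mat k p) (N : Mat p m) c i → (M · (N · c)) i ≡ ((M ⊗ N) · c) i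
·-assoc {p = p} {m = m} M N c i = begin
    Σ[< p ] (λ q → M i q * Σ[< m ] (λ l → N q l * c l))
      ≡⟨ Σ-cong p (λ q → sym (Σ-*ˡ m (M i q) (λ l → N q l * c l))) ⟩
    Σ[< p ] (λ q → Σ[< m ] (λ l → M i q * (N q l * c l)))
      ≡⟨ Σ-swap p m (λ q l → M i q * (N q l * c l)) ⟩
    Σ[< m ] (λ l → Σ[< p ] (λ q → M i q * (N q l * c l)))
      ≡⟨ Σ-cong m (λ l → Σ-cong p (λ q → sym (ℚ.*-assoc (M i q) (N q l) (c l)))) ⟩
    Σ[< m ] (λ l → Σ[< p ] (λ q → M i q * N q l * c l))
      ≡⟨ Σ-cong m (λ l → Σ-*ʳ p (c l) (λ q → M i q * N q l)) ⟩
    Σ[< m ] (λ l → (M ⊗ N) i l * c l) ∎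
  where open ≡-Reasoning

⊗-kernel : ∀ {k p m} (M : Mat k p) (N : Mat p m) {c} → InKernel N c → InKernel (M ⊗ N) c
⊗-kernel M N {c} Nc≡0 i =
  trans (sym (·-assoc M N c i))
        (Σ-zero _ (λ q → *-vanishʳ (M i q) (Nc≡0 q)))

unit : ∀ {n} → Fin n → Vec n
unit zero    zero    = 1ℚ
unit zero    (suc _) = 0ℚ
unit (suc _) zero    = 0ℚ
unit (suc j) (suc p) = unit j p

Σ-unit : ∀ n (f : Fin n → ℚ) j → Σ[< n ] (λ p → f p * unit j p) ≡ f j
Σ-unit (suc n) f zero = begin
    f zero * 1ℚ + Σ[< n ] (λ p → f (suc p) * 0ℚ)
      ≡⟨ cong₂ _+_ (ℚ.*-identityʳ (f zero)) (Σ-zero n (λ p → ℚ.*-zeroʳ (f (suc p)))) ⟩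
    f zero + 0ℚ
      ≡⟨ ℚ.+-identityʳ (f zero) ⟩
    f zero ∎
  where open ≡-Reasoning
Σ-unit (suc n) f (suc j) =
  trans (cong₂ _+_ (ℚ.*-zeroʳ (f zero)) (Σ-unit n (f ∘ suc) j)) (ℚ.+-identityˡ (f (suc j)))

columns : ∀ {n m} → (Fin m → Vec n) → Mat n m
columns v p l = v l p

eliminate : ∀ {k m} (M : Mat (suc k) (suc m)) (p₀ : Fin (suc k)) →
            .{{NonZero (M p₀ zero)}} → Mat k m
eliminate M p₀ q l = M p (suc l) - (M p zero * 1/ M p₀ zero) * M p₀ (suc l)
  where p = punchIn p₀ q

-- A solution c of the eliminated system extends to a solution x ∷ c of the
-- original one, x being determined by the pivot row.
back-substitute : ∀ {k m} (M : Mat (suc k) (suc m)) (p₀ : Fin (suc k))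
                  .{{_ : NonZero (M p₀ zero)}} (c : Vec m) →
                  InKernel (eliminate M p₀) c → ∃ λ x → InKernel M (x ∷ c)
back-substitute {k} {m} M p₀ c reduced = x , solves
  where
    u : ℚ
    u = 1/ M p₀ zero
    rest : Fin (suc k) → ℚ
    rest p = Σ[< m ] (λ l → M p (suc l) * c l)
    x : ℚ
    x = - (rest p₀ * u)

    residual : Fin (suc k) → ℚ
    residual p = rest p - (M p zero * u) * rest p₀

    row-is-residual : ∀ p → (M · (x ∷ c)) p ≡ residual p
    row-is-residual p = solve 4 (λ a r u s → a :* (:- (s :* u)) :+ r := r :- (a :* u) :* s)
                                refl (M p zero) (rest p) u (rest p₀)

    pivot-residual : residual p₀ ≡ 0ℚ
    pivot-residual = begin
        rest p₀ - (M p₀ zero * u) * rest p₀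
          ≡⟨ cong (λ z → rest p₀ - z * rest p₀) (ℚ.*-inverseʳ (M p₀ zero)) ⟩
        rest p₀ - 1ℚ * rest p₀
          ≡⟨ cong (_-_ (rest p₀)) (ℚ.*-identityˡ (rest p₀)) ⟩
        rest p₀ - rest p₀
          ≡⟨ ℚ.+-inverseʳ (rest p₀) ⟩
        0ℚ ∎
      where open ≡-Reasoning

    other-residual : ∀ q → residual (punchIn p₀ q) ≡ (eliminate M p₀ · c) q
    other-residual q = begin
        rest p - κ * rest p₀
          ≡⟨ cong (_-_ (rest p)) (sym (Σ-*ˡ m κ (λ l → M p₀ (suc l) * c l))) ⟩
        rest p - Σ[< m ] (λ l → κ * (M p₀ (suc l) * c l))
          ≡⟨ sym (Σ-- m (λ l → M p (suc l) * c l) (λ l → κ * (M p₀ (suc l) * c l))) ⟩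
        Σ[< m ] (λ l → M p (suc l) * c l - κ * (M p₀ (suc l) * c l))
          ≡⟨ Σ-cong m (λ l → distrib (M p (suc l)) κ (M p₀ (suc l)) (c l)) ⟩
        (eliminate M p₀ · c) q ∎
      where
        open ≡-Reasoning
        p : Fin (suc k)
        p = punchIn p₀ q
        κ : ℚ
        κ = M p zero * u
        distrib : ∀ a k b c → a * c - k * (b * c) ≡ (a - k * b) * c
        distrib = solve 4 (λ a k b c → a :* c :- k :* (b :* c) := (a :- k :* b) :* c) refl

    residual-vanishes : ∀ p → residual p ≡ 0ℚ
    residual-vanishes p with p₀ ≟ᶠ p
    ... | yes refl   = pivot-residual
    ... | no  p₀≢p = subst (λ p → residual p ≡ 0ℚ) (punchIn-punchOut p₀≢p)
                           (trans (other-residual q) (reduced q))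
      where
        q : Fin k
        q = punchOut p₀≢p

    solves : InKernel M (x ∷ c)
    solves p = trans (row-is-residual p) (residual-vanishes p)

homogeneous-nontrivial : ∀ {k m} → k < m → (M : Mat k m) → ∃ λ c → Nontrivial c × InKernel M c
homogeneous-nontrivial {zero} {suc m} _ M = unit zero , (zero , ℚ.1≢0) , λ ()
homogeneous-nontrivial {suc k} {suc m} (s≤s k<m) M with all? (λ p → M p zero ≟ 0ℚ)
... | yes column₀≡0 =
  unit zero , (zero , ℚ.1≢0) , λ p → trans (Σ-unit (suc m) (M p) zero) (column₀≡0 p)
... | no ¬column₀≡0 with ¬∀⟶∃¬ _ (λ p → M p zero ≡ 0ℚ) (λ p → M p zero ≟ 0ℚ) ¬column₀≡0
...   | p₀ , pivot≢0 with homogeneous-nontrivial k<m (eliminate M p₀ {{≢-nonZero pivot≢0}})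
...     | c , (l , cₗ≢0) , reduced = proj₁ extended ∷ c , (suc l , cₗ≢0) , proj₂ extended
  where
    extended : ∃ λ x → InKernel M (x ∷ c)
    extended = back-substitute M p₀ {{≢-nonZero pivot≢0}} c reduced

-- If D i i = D j j = 0 while D i j, D j i ≠ 0, then D is injective on
-- span(e_i, e_j); hence any r ≥ n − 1 vectors killed by D are dependent.
dependent-in-kernel : ∀ {n r} → n ≤ suc r → (D : Mat n n) {i j : Fin n} →
                      D i i ≡ 0ℚ → D j j ≡ 0ℚ → D i j ≢ 0ℚ → D j i ≢ 0ℚ →
                      (v : Fin r → Vec n) → (∀ l → InKernel D (v l)) →
                      ∃ λ c → Nontrivial c × InKernel (columns v) c
dependent-in-kernel {n} {r} n≤1+r D {i} {j} Dii≡0 Djj≡0 Dij≢0 Dji≢0 v Dv≡0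
  with homogeneous-nontrivial (s≤s n≤1+r) (columns (unit i ∷ unit j ∷ v))
... | cc , nontrivial , relation = c , c-nontrivial nontrivial , c-relation
  where
    N : Mat n (suc (suc r))
    N = columns (unit i ∷ unit j ∷ v)
    a b : ℚ
    a = cc zero
    b = cc (suc zero)
    c : Vec r
    c l = cc (suc (suc l))

    -- Applying D to the relation a e_i + b e_j + Σ_l c_l v_l = 0 kills the v_l.
    image : ∀ x → D x i * a + D x j * b ≡ 0ℚ
    image x = begin
        D x i * a + D x j * b
          ≡⟨ cong (D x i * a +_) (sym (ℚ.+-identityʳ (D x j * b))) ⟩
        D x i * a + (D x j * b + 0ℚ)
          ≡⟨ cong (λ z → D x i * a + (D x j * b + z)) (sym v-terms) ⟩
        D x i * a + (D x j * b + Σ[< r ] (λ l → (D ⊗ N) x (suc (suc l)) * c l))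
          ≡⟨ sym (cong₂ (λ s t → s * a + (t * b + Σ[< r ] (λ l → (D ⊗ N) x (suc (suc l)) * c l)))
                        (Σ-unit n (D x) i) (Σ-unit n (D x) j)) ⟩
        ((D ⊗ N) · cc) x
          ≡⟨ ⊗-kernel D N {cc} relation x ⟩
        0ℚ ∎
      where
        open ≡-Reasoning
        v-terms : Σ[< r ] (λ l → (D ⊗ N) x (suc (suc l)) * c l) ≡ 0ℚ
        v-terms = Σ-zero r (λ l → *-vanishˡ (c l) (Dv≡0 l x))

    b≡0 : b ≡ 0ℚ
    b≡0 = *-cancel-zeroˡ (D i j) b
            (+-cancel-zeroˡ (*-vanishˡ a Dii≡0) (image i)) Dij≢0

    a≡0 : a ≡ 0ℚ
    a≡0 = *-cancel-zeroˡ (D j i) a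
            (+-cancel-zeroʳ (*-vanishˡ b Djj≡0) (image j)) Dji≢0

    c-nontrivial : Nontrivial cc → Nontrivial c
    c-nontrivial (zero , a≢0)          = ⊥-elim (a≢0 a≡0)
    c-nontrivial (suc zero , b≢0)      = ⊥-elim (b≢0 b≡0)
    c-nontrivial (suc (suc l) , cₗ≢0) = l , cₗ≢0

    c-relation : InKernel (columns v) c
    c-relation p = +-cancel-zeroˡ (*-vanishʳ (unit j p) b≡0)
                     (+-cancel-zeroˡ (*-vanishʳ (unit i p) a≡0) (relation p))

kernel-pair-dependent : ∀ {m n r} → n ≤ suc r → (W : Mat m n) (f : Fin r → Fin n) →
                        ColumnsIndependent W f → (u v : Vec n) → InKernel W u → InKernel W v →
                        ∃₂ λ b₀ b₁ → (b₀ ≢ 0ℚ ⊎ b₁ ≢ 0ℚ) × (∀ p → u p * b₀ + v p * b₁ ≡ 0ℚ)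
kernel-pair-dependent {n = n} {r = r} n≤1+r W f independent u v Wu≡0 Wv≡0
  with homogeneous-nontrivial (s≤s n≤1+r) (columns (u ∷ v ∷ (λ l → unit (f l))))
... | cc , nontrivial , relation = b₀ , b₁ , b-nontrivial nontrivial , b-relation
  where
    N : Mat n (suc (suc r))
    N = columns (u ∷ v ∷ (λ l → unit (f l)))
    b₀ b₁ : ℚ
    b₀ = cc zero
    b₁ = cc (suc zero)
    a : Vec r
    a l = cc (suc (suc l))

    -- Applying W to the relation b₀ u + b₁ v + Σ_l a_l e_{f l} = 0 leaves a
    -- relation among the independent columns W e_{f l}.
    column-relation : ∀ q → Σ[< r ] (λ l → W q (f l) * a l) ≡ 0ℚ
    column-relation q = begin
        Σ[< r ] (λ l → W q (f l) * a l)
          ≡⟨ sym (Σ-cong r (λ l → cong (_* a l) (Σ-unit n (W q) (f l)))) ⟩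
        Σ[< r ] (λ l → (W ⊗ N) q (suc (suc l)) * a l)
          ≡⟨ +-cancel-zeroˡ (*-vanishˡ b₁ (Wv≡0 q)) (+-cancel-zeroˡ (*-vanishˡ b₀ (Wu≡0 q))
                                                                  (⊗-kernel W N {cc} relation q)) ⟩
        0ℚ ∎
      where open ≡-Reasoning

    a≡0 : ∀ l → a l ≡ 0ℚ
    a≡0 = independent a column-relation

    b-nontrivial : Nontrivial cc → b₀ ≢ 0ℚ ⊎ b₁ ≢ 0ℚ
    b-nontrivial (zero , b₀≢0)         = inj₁ b₀≢0
    b-nontrivial (suc zero , b₁≢0)     = inj₂ b₁≢0
    b-nontrivial (suc (suc l) , aₗ≢0) = ⊥-elim (aₗ≢0 (a≡0 l))

    b-relation : ∀ p → u p * b₀ + v p * b₁ ≡ 0ℚ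
    b-relation p = trans (cong (u p * b₀ +_) (sym (trans (cong (v p * b₁ +_) unit-terms)
                                                          (ℚ.+-identityʳ (v p * b₁)))))
                         (relation p)
      where
        unit-terms : Σ[< r ] (λ l → unit (f l) p * a l) ≡ 0ℚ
        unit-terms = Σ-zero r (λ l → *-vanishʳ (unit (f l) p) (a≡0 l))

-- Coefficient vectors of length r + 1 built from c ∈ ℚ^r: c followed by a
-- zero (pad c), and c shifted right by one (0ℚ ∷ c).
pad : ∀ {r} → Vec r → Vec (suc r)
pad {zero}  c zero    = 0ℚ
pad {suc r} c zero    = c zero
pad {suc r} c (suc p) = pad (c ∘ suc) p

-- If b₀ ≠ 0, the relations b₀ (c, 0) + b₁ (x, c) = 0 with x = 0 force
-- c₀ = 0, then c₁ = 0, and so on.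
pad-shift-forward : ∀ {r} (c : Vec r) x b₀ b₁ → b₀ ≢ 0ℚ → x ≡ 0ℚ →
                    (∀ p → pad c p * b₀ + (x ∷ c) p * b₁ ≡ 0ℚ) → ∀ l → c l ≡ 0ℚ
pad-shift-forward {suc r} c x b₀ b₁ b₀≢0 x≡0 relation zero =
  *-cancel-zeroʳ (c zero) b₀
    (+-cancel-zeroʳ (*-vanishˡ b₁ x≡0) (relation zero)) b₀≢0
pad-shift-forward {suc r} c x b₀ b₁ b₀≢0 x≡0 relation (suc l) =
  pad-shift-forward (c ∘ suc) (c zero) b₀ b₁ b₀≢0
    (pad-shift-forward c x b₀ b₁ b₀≢0 x≡0 relation zero) shifted l
  where
    shifted : ∀ p → pad (c ∘ suc) p * b₀ + (c zero ∷ c ∘ suc) p * b₁ ≡ 0ℚ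
    shifted zero    = relation (suc zero)
    shifted (suc p) = relation (suc (suc p))

pad-shift-independent : ∀ {r} (c : Vec r) → Nontrivial c → ∀ b₀ b₁ →
                        (∀ p → pad c p * b₀ + (0ℚ ∷ c) p * b₁ ≡ 0ℚ) → b₀ ≡ 0ℚ × b₁ ≡ 0ℚ
pad-shift-independent c (l , cₗ≢0) b₀ b₁ relation with b₀ ≟ 0ℚ | b₁ ≟ 0ℚ
... | no b₀≢0  | _        = ⊥-elim (cₗ≢0 (pad-shift-forward c 0ℚ b₀ b₁ b₀≢0 refl relation l))
... | yes b₀≡0 | yes b₁≡0 = b₀≡0 , b₁≡0
... | yes b₀≡0 | no b₁≢0  = ⊥-elim (cₗ≢0 (*-cancel-zeroʳ (c l) b₁ cₗb₁≡0 b₁≢0))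
  where
    cₗb₁≡0 : c l * b₁ ≡ 0ℚ
    cₗb₁≡0 = +-cancel-zeroˡ (*-vanishʳ (pad c (suc l)) b₀≡0) (relation (suc l))

-- The Krylov matrix [e, A e, …, A^{m−1} e]; the walk matrix of (G, S) is
-- krylov (adjMat G) (charVec S) n.
krylov : ∀ {n} → Mat n n → Vec n → (m : ℕ) → Mat n m
krylov A e m i j = powApply A (toℕ j) e i

Σ-pad : ∀ {r} (g : ℕ → ℚ) (c : Vec r) →
        Σ[< suc r ] (λ j → g (toℕ j) * pad c j) ≡ Σ[< r ] (λ l → g (toℕ l) * c l)
Σ-pad {zero}  g c = trans (ℚ.+-identityʳ (g 0 * 0ℚ)) (ℚ.*-zeroʳ (g 0))
Σ-pad {suc r} g c = cong (g 0 * c zero +_) (Σ-pad (g ∘ suc) (c ∘ suc))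

-- A relation Σ_{l<r} c_l A^l e = 0 gives two kernel vectors of the Krylov
-- matrix with r + 1 columns: pad c, and 0 ∷ c, because
-- Σ_l c_l A^{l+1} e = A (Σ_l c_l A^l e) = 0.
krylov-pad : ∀ {n r} (A : Mat n n) (e : Vec n) (c : Vec r) →
             InKernel (krylov A e r) c → InKernel (krylov A e (suc r)) (pad c)
krylov-pad A e c relation i = trans (Σ-pad (λ t → powApply A t e i) c) (relation i)

krylov-shift : ∀ {n r} (A : Mat n n) (e : Vec n) (c : Vec r) →
               InKernel (krylov A e r) c → InKernel (krylov A e (suc r)) (0ℚ ∷ c)
krylov-shift A e c relation i =
  trans (cong₂ _+_ (ℚ.*-zeroʳ (e i)) (⊗-kernel A (krylov A e _) {c} relation i)) (ℚ.+-identityˡ 0ℚ)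

krylov-prefix-independent : ∀ {n r} (A : Mat n n) (e : Vec n) →
                            RankAtLeast (krylov A e (suc r)) r →
                            (c : Vec r) → Nontrivial c → InKernel (krylov A e r) c → ⊥
krylov-prefix-independent A e (f , _ , independent) c c≢0 relation =
  contradiction (kernel-pair-dependent ≤-refl (krylov A e _) f independent (pad c) (0ℚ ∷ c)
                   (krylov-pad A e c relation) (krylov-shift A e c relation))
  where
    contradiction : (∃₂ λ b₀ b₁ → (b₀ ≢ 0ℚ ⊎ b₁ ≢ 0ℚ) ×
                                   (∀ p → pad c p * b₀ + (0ℚ ∷ c) p * b₁ ≡ 0ℚ)) → ⊥
    contradiction (b₀ , b₁ , inj₁ b₀≢0 , dependence) =
      b₀≢0 (proj₁ (pad-shift-independent c c≢0 b₀ b₁ dependence))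
    contradiction (b₀ , b₁ , inj₂ b₁≢0 , dependence) =
      b₁≢0 (proj₂ (pad-shift-independent c c≢0 b₀ b₁ dependence))

adjDiff : ∀ {n} → Graph n → Graph n → Mat n n
adjDiff G G* i j = adjMat G i j - adjMat G* i j

adjDiff-diagonal : ∀ {n} (G G* : Graph n) i → adjDiff G G* i i ≡ 0ℚ
adjDiff-diagonal G G* i rewrite irreflexive G i | irreflexive G* i = refl

adjDiff-symmetric : ∀ {n} (G G* : Graph n) i j → adjDiff G G* i j ≡ adjDiff G G* j i
adjDiff-symmetric G G* i j rewrite symmetric G i j | symmetric G* i j = refl

walks-agree : ∀ {n} (G G* : Graph n) (S S* : Subset n) →
              (∀ i j → walkMatrix G S i j ≡ walkMatrix G* S* i j) → ∀ t → t < n → ∀ p →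
              powApply (adjMat G) t (charVec S) p ≡ powApply (adjMat G*) t (charVec S*) p
walks-agree G G* S S* W≡W* t t<n p =
  subst (λ s → powApply (adjMat G) s (charVec S) p ≡ powApply (adjMat G*) s (charVec S*) p)
        (toℕ-fromℕ< t<n) (W≡W* p (fromℕ< t<n))

-- Hence D annihilates A^t e whenever t + 1 < n:
-- D A^t e = A^{t+1} e − A* A*^t e* = A^{t+1} e − A*^{t+1} e* = 0.
adjDiff-kills-walks : ∀ {n} (G G* : Graph n) (S S* : Subset n) →
                      (∀ i j → walkMatrix G S i j ≡ walkMatrix G* S* i j) →
                      ∀ t → suc t < n → InKernel (adjDiff G G*) (powApply (adjMat G) t (charVec S))
adjDiff-kills-walks {n} G G* S S* W≡W* t 1+t<n x = begin
    Σ[< n ] (λ p → (A x p - A* x p) * w t p)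
      ≡⟨ Σ-cong n (λ p → [y-z]x≈yx-zx (w t p) (A x p) (A* x p)) ⟩
    Σ[< n ] (λ p → A x p * w t p - A* x p * w t p)
      ≡⟨ Σ-- n (λ p → A x p * w t p) (λ p → A* x p * w t p) ⟩
    w (suc t) x - (A* · w t) x
      ≡⟨ cong₂ _-_ (agree (suc t) 1+t<n x)
                   (Σ-cong n (λ p → cong (A* x p *_) (agree t (<⇒≤ 1+t<n) p))) ⟩
    w* (suc t) x - w* (suc t) x
      ≡⟨ ℚ.+-inverseʳ (w* (suc t) x) ⟩
    0ℚ ∎
  where
    open ≡-Reasoning
    A A* : Mat n n
    A  = adjMat G
    A* = adjMat G*
    w w* : ℕ → Vec n
    w  t = powApply A t (charVec S)
    w* t = powApply A* t (charVec S*)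
    agree : ∀ t → t < n → ∀ p → w t p ≡ w* t p
    agree = walks-agree G G* S S* W≡W*

-- If A i j ≠ A* i j, then D kills the n − 1 walk vectors e, A e, …,
-- A^{n−2} e, so they are dependent; but the walk matrix has rank n − 1, so
-- they are independent.
theorem5p5 : (n : ℕ) (G G* : Graph n) (S S* : Subset n) →
             NonEmpty S → NonEmpty S* →
             (∀ i j → walkMatrix G S i j ≡ walkMatrix G* S* i j) →
             HasRank (walkMatrix G S) (n ∸ 1) →
             ∀ i j → adjMat G i j ≡ adjMat G* i j
theorem5p5 zero    _ _  _ _  _ _ _     _    () _
theorem5p5 (suc n) G G* S S* _ _ W≡W* rank i j with adjMat G i j ≟ adjMat G* i j
... | yes Aij≡A*ij = Aij≡A*ij
... | no  Aij≢A*ij = ⊥-elim (krylov-prefix-independent (adjMat G) (charVec S) (proj₁ rank)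
                               c c≢0 walk-relation)
  where
    D : Mat (suc n) (suc n)
    D = adjDiff G G*

    Dij≢0 : D i j ≢ 0ℚ
    Dij≢0 = Aij≢A*ij ∘ x∙y⁻¹≈ε⇒x≈y (adjMat G i j) (adjMat G* i j)

    Dji≢0 : D j i ≢ 0ℚ
    Dji≢0 = Dij≢0 ∘ trans (adjDiff-symmetric G G* i j)

    dependence : ∃ λ c → Nontrivial c × InKernel (krylov (adjMat G) (charVec S) n) c
    dependence = dependent-in-kernel ≤-refl D (adjDiff-diagonal G G* i) (adjDiff-diagonal G G* j)
                   Dij≢0 Dji≢0 (λ l → powApply (adjMat G) (toℕ l) (charVec S))
                   (λ l → adjDiff-kills-walks G G* S S* W≡W* (toℕ l) (s≤s (toℕ<n l)))

    c : Vec n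
    c = proj₁ dependence
    c≢0 : Nontrivial c
    c≢0 = proj₁ (proj₂ dependence)
    walk-relation : InKernel (krylov (adjMat G) (charVec S) n) c
    walk-relation = proj₂ (proj₂ dependence)
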